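{- For a tree $T$ of order $n$, $vcfc(T)\leq vcfc(P_n)$, where $P_n$ is the path on $n$ vertices.
   Context: Graphs are finite, simple and undirected. A path in a vertex-colored graph is called conflict-free if there is a color used on exactly one of its vertices. A vertex-colored graph is conflict-free vertex-connected if any two vertices of the graph are connected by a conflict-free path. The conflict-free vertex-connection number $vcfc(G)$ of a connected graph $G$ is the smallest number of colors required in a vertex-coloring of $G$ that makes $G$ conflict-free vertex-connected. -}

module Defs where

import Data.Nat.Properties
open import Data.Nat using (ℕ; suc; _≤_; _<_)
open import Data.Fin using (Fin; toℕ; _≟_)
open import Data.List using (List; []; _∷_; length; filter)
open import Data.List.Relation.Unary.Unique.Propositional using (Unique)
open import Data.Product using (Σ; ∃; _×_)
open import Data.Sum using (_⊎_)
open import Data.Empty using (⊥)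
open import Relation.Binary.PropositionalEquality using (_≡_)
open import Relation.Nullary using (¬_)

record Graph (n : ℕ) : Set₁ where
  field
    Adj     : Fin n → Fin n → Set
    sym     : ∀ {u v} → Adj u v → Adj v u
    irrefl  : ∀ {u} → ¬ Adj u u
open Graph public

module _ {n : ℕ} (G : Graph n) where

  data IsWalk : Fin n → Fin n → List (Fin n) → Set where
    single : ∀ {u} → IsWalk u u (u ∷ [])
    step   : ∀ {u w v p} → Adj G u w → IsWalk w v p → IsWalk u v (u ∷ p)

  IsPath : Fin n → Fin n → List (Fin n) → Set
  IsPath u v p = IsWalk u v p × Unique p

  Connected : Set
  Connected = ∀ u v → ∃ λ p → IsPath u v p

  -- a cycle: distinct vertices v0 … vk with k ≥ 2, consecutive ones adjacent,
  -- and vk adjacent to v0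
  HasCycle : Set
  HasCycle = Σ (Fin n) λ u → Σ (Fin n) λ v → Σ (List (Fin n)) λ p →
    IsPath u v p × (3 ≤ length p) × Adj G v u

  IsTree : Set
  IsTree = Connected × ¬ HasCycle

  ConflictFree : {k : ℕ} → (Fin n → Fin k) → List (Fin n) → Set
  ConflictFree {k} c p = ∃ λ (col : Fin k) → length (filter (λ x → c x ≟ col) p) ≡ 1

  CFVConnected : {k : ℕ} → (Fin n → Fin k) → Set
  CFVConnected c = ∀ u v → ∃ λ p → IsPath u v p × ConflictFree c p

  CFVColourable : ℕ → Set
  CFVColourable k = Σ (Fin n → Fin k) CFVConnected

  IsVcfc : ℕ → Set
  IsVcfc k = CFVColourable k × (∀ j → j < k → ¬ CFVColourable j)

PathGraph : (n : ℕ) → Graph n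
PathGraph n = record
  { Adj    = λ i j → (toℕ j ≡ suc (toℕ i)) ⊎ (toℕ i ≡ suc (toℕ j))
  ; sym    = λ { (Data.Sum.inj₁ e) → Data.Sum.inj₂ e ; (Data.Sum.inj₂ e) → Data.Sum.inj₁ e }
  ; irrefl = λ { (Data.Sum.inj₁ e) → n≢1+n e ; (Data.Sum.inj₂ e) → n≢1+n e }
  }
  where
    n≢1+n : ∀ {m : ℕ} → m ≡ suc m → ⊥
    n≢1+n {ℕ.zero} ()
    n≢1+n {suc m} e = n≢1+n {m} (Data.Nat.Properties.suc-injective e)

module Submission where

-- Both sides are compared with the threshold n < 2^b.
-- * Paths (path-lower-bound): a conflict-free colouring of P_n with b colours
--   forces n < 2^b.  Every segment of the vertex list 0, 1, …, n-1 is the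
--   unique path between its ends, hence conflict-free; the colour occurring
--   once on the whole list splits it into two shorter such lists avoiding
--   that colour, and induction on b bounds the length (Segments).
-- * Trees (Ranking.tree-colourable): if n < 2^b, centroid decomposition
--   colours T with b colours so that every path has a unique vertex of
--   maximal colour, which makes every path conflict-free.
-- So b = vcfc(P_n) colours suffice for T, and vcfc(T) ≤ b by minimality.

open import Defs
open import Data.Nat using (ℕ; zero; suc; _+_; _*_; _^_; _≤_; _<_; _<?_; z≤n; s≤s)
open import Data.Nat.Properties
  using (≤-refl; ≤-reflexive; ≤-trans; ≤-pred; <-≤-trans; ≤-<-trans; <-trans; <⇒≤;
         ≤∧≢⇒<; <-irrefl; ≤⇒≯; ≮⇒≥; <-cmp; n<1+n; n≤1+n; m≤n⇒m≤1+n; suc-injective;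
         +-suc; +-comm; +-identityʳ; +-monoʳ-≤; +-mono-≤; +-cancelʳ-≤; *-monoʳ-≤;
         *-cancelˡ-<; m^n>0; module ≤-Reasoning)
  renaming (_≟_ to _≟ℕ_)
open import Data.Fin using (Fin; toℕ; fromℕ<; _≟_) renaming (zero to fzero; suc to fsuc)
open import Data.Fin.Properties using (toℕ-injective; toℕ-fromℕ<)
  renaming (all? to all-Fin?; any? to any-Fin?)
open import Data.List using (List; []; _∷_; _++_; length; filter; tabulate; allFin)
open import Data.List.Properties
  using (++-assoc; ++-identityʳ; length-++; length-tabulate;
         filter-accept; filter-reject; filter-none; filter-notAll)
open import Data.List.Relation.Unary.Any using (Any; here; there) renaming (any? to any-List?)
import Data.List.Relation.Unary.Any as Any
open import Data.List.Relation.Unary.All using (All; []; _∷_) renaming (all? to all-List?)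
import Data.List.Relation.Unary.All as All
open import Data.List.Relation.Unary.All.Properties using (All¬⇒¬Any; ¬Any⇒All¬)
open import Data.List.Relation.Unary.AllPairs using ([]; _∷_)
open import Data.List.Relation.Unary.Unique.Propositional using (Unique)
open import Data.List.Membership.Propositional using (_∈_; _∉_; find)
open import Data.List.Membership.Propositional.Properties
  using (∈-++⁺ˡ; ∈-++⁺ʳ; ∈-++⁻; ∈-∃++; ∈-filter⁺; ∈-allFin)
open import Data.List.Relation.Binary.Subset.Propositional using (_⊆_)
open import Data.Product using (∃; ∃₂; _×_; _,_; proj₁; proj₂)
open import Data.Sum using (_⊎_; inj₁; inj₂; [_,_])
open import Data.Unit using (⊤; tt)
open import Data.Empty using (⊥; ⊥-elim)
open import Function using (_∘_; id)
open import Relation.Binary using (DecidableEquality; tri<; tri≈; tri>)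
open import Relation.Binary.PropositionalEquality
  using (_≡_; _≢_; refl; cong; trans; subst; subst₂; module ≡-Reasoning) renaming (sym to ≡-sym)
open import Relation.Nullary using (¬_; yes; no; ¬?; _×-dec_; _→-dec_)
open import Relation.Unary using (Decidable)

private
  variable
    A : Set
    ys : List A

unique-++ʳ : ∀ (xs : List A) → Unique (xs ++ ys) → Unique ys
unique-++ʳ []       u       = u
unique-++ʳ (_ ∷ xs) (_ ∷ u) = unique-++ʳ xs u

unique-disjoint : ∀ {x : A} (xs : List A) → Unique (xs ++ ys) → x ∈ xs → x ∉ ys
unique-disjoint (_ ∷ xs) (px ∷ _) (here refl) x∈ys = All¬⇒¬Any px (∈-++⁺ʳ xs x∈ys)
unique-disjoint (_ ∷ xs) (_ ∷ u)  (there x∈xs) = unique-disjoint xs u x∈xs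

filter-single : ∀ {P : A → Set} (P? : Decidable P) {x} {xs : List A} → Unique xs →
                x ∈ xs → P x → (∀ {y} → y ∈ xs → y ≢ x → ¬ P y) →
                length (filter P? xs) ≡ 1
filter-single {P = P} P? {x} {_ ∷ ys} (x≢ ∷ _) (here refl) px others = begin
  length (filter P? (x ∷ ys))  ≡⟨ cong length (filter-accept P? px) ⟩
  suc (length (filter P? ys))  ≡⟨ cong (suc ∘ length) (filter-none P? no-other) ⟩
  1                            ∎
  where
  open ≡-Reasoning
  no-other : All (¬_ ∘ P) ys
  no-other = All.tabulate (λ y∈ → others (there y∈) (λ { refl → All.lookup x≢ y∈ refl }))
filter-single P? (y≢ ∷ u) (there x∈) px others =
  trans (cong length (filter-reject P? (others (here refl) (λ { refl → All.lookup y≢ x∈ refl }))))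
        (filter-single P? u x∈ px (others ∘ there))

module Walks {n : ℕ} (G : Graph n) where

  open import Data.List.Membership.DecPropositional (_≟_ {n}) using (_∈?_)

  private
    variable
      u v w : Fin n
      p q : List (Fin n)

  walk-start : IsWalk G u v p → u ∈ p
  walk-start single     = here refl
  walk-start (step _ _) = here refl

  walk-end : IsWalk G u v p → v ∈ p
  walk-end single      = here refl
  walk-end (step _ wk) = there (walk-end wk)

  walk-length : IsWalk G u v p → u ≢ v → 2 ≤ length p
  walk-length single             u≢v = ⊥-elim (u≢v refl)
  walk-length (step _ single)     _  = s≤s (s≤s z≤n)
  walk-length (step _ (step _ _)) _  = s≤s (s≤s z≤n)

  walk-++ : IsWalk G u w p → IsWalk G w v q → ∃ λ r → IsWalk G u v r × r ⊆ p ++ q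
  walk-++ {q = q} single wq = q , wq , there
  walk-++ (step e wp) wq with r , wr , r⊆ ← walk-++ wp wq =
    _ , step e wr , λ { (here refl) → here refl ; (there x∈r) → there (r⊆ x∈r) }

  walk-reverse : IsWalk G u v p → ∃ λ r → IsWalk G v u r × r ⊆ p
  walk-reverse single = _ , single , λ x∈p → x∈p
  walk-reverse {p = u ∷ p} (step {w = w} e wp)
    with r , wr , r⊆p ← walk-reverse wp
    with s , ws , s⊆ ← walk-++ wr (step (Graph.sym G e) single)
    = s , ws , λ x∈s → [ there ∘ r⊆p , back ] (∈-++⁻ r (s⊆ x∈s))
    where
    back : ∀ {x} → x ∈ w ∷ u ∷ [] → x ∈ u ∷ p
    back (here refl)         = there (walk-start wp)
    back (there (here refl)) = here refl

  walk-prefix : ∀ xs {ys} → IsWalk G u v (xs ++ w ∷ ys) → IsWalk G u w (xs ++ w ∷ [])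
  walk-prefix []             single              = single
  walk-prefix []             (step _ _)          = single
  walk-prefix (_ ∷ [])       (step e single)     = step e single
  walk-prefix (_ ∷ [])       (step e (step _ _)) = step e single
  walk-prefix (_ ∷ x ∷ xs)   (step e wk)         = step e (walk-prefix (x ∷ xs) wk)

  walk-suffix : ∀ xs {ys} → IsWalk G u v (xs ++ w ∷ ys) → IsWalk G w v (w ∷ ys)
  walk-suffix []       wk          = same-start wk
    where
    same-start : ∀ {u v w p} → IsWalk G u v (w ∷ p) → IsWalk G w v (w ∷ p)
    same-start single      = single
    same-start (step e wk) = step e wk
  walk-suffix (_ ∷ [])     (step _ wk) = walk-suffix [] wk
  walk-suffix (_ ∷ x ∷ xs) (step _ wk) = walk-suffix (x ∷ xs) wk

  loop-erasure : IsWalk G u v p → ∃ λ q → IsPath G u v q × q ⊆ p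
  loop-erasure single = _ , (single , [] ∷ []) , λ x∈p → x∈p
  loop-erasure {u} (step e wp) with loop-erasure wp
  ... | q , (wq , uq) , q⊆p with u ∈? q
  ... | yes u∈q with xs , ys , refl ← ∈-∃++ u∈q =
    u ∷ ys , (walk-suffix xs wq , unique-++ʳ xs uq) ,
    λ { (here refl) → here refl ; (there x∈ys) → there (q⊆p (∈-++⁺ʳ xs (there x∈ys))) }
  ... | no u∉q =
    u ∷ q , (step e wq , ¬Any⇒All¬ q u∉q ∷ uq) ,
    λ { (here refl) → here refl ; (there x∈q) → there (q⊆p x∈q) }

  -- In a graph without cycles two vertices are joined by at most one path:
  -- two different paths from u to v leaving u through different neighbours
  -- w₁ ≠ w₂ would combine into a walk w₁ → v → w₂ avoiding u, whose loop
  -- erasure closes up with u into a cycle.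
  module Acyclic (acyclic : ¬ HasCycle G) where

    path-unique : IsPath G u v p → IsPath G u v q → p ≡ q
    path-unique (single , _) (single , _) = refl
    path-unique (single , _) (step _ wq , q₀ ∷ _) = ⊥-elim (All¬⇒¬Any q₀ (walk-end wq))
    path-unique (step _ wp , p₀ ∷ _) (single , _) = ⊥-elim (All¬⇒¬Any p₀ (walk-end wp))
    path-unique {u} (step {w = w₁} e₁ wp , p₀ ∷ up) (step {w = w₂} e₂ wq , q₀ ∷ uq)
      with w₁ ≟ w₂
    ... | yes refl = cong (u ∷_) (path-unique (wp , up) (wq , uq))
    ... | no w₁≢w₂
      with back , wback , back⊆q ← walk-reverse wq
      with around , waround , around⊆ ← walk-++ wp wback
      with r , (wr , ur) , r⊆around ← loop-erasure waround =
      ⊥-elim (acyclic (u , w₂ , u ∷ r , (step e₁ wr , ¬Any⇒All¬ r u∉r ∷ ur) ,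
                       s≤s (walk-length wr w₁≢w₂) , Graph.sym G e₂))
      where
      u∉r : u ∉ r
      u∉r u∈r with ∈-++⁻ _ (around⊆ (r⊆around u∈r))
      ... | inj₁ u∈p    = All¬⇒¬Any p₀ u∈p
      ... | inj₂ u∈back = All¬⇒¬Any q₀ (back⊆q u∈back)

module TreePaths {n : ℕ} (T : Graph n) (tree : IsTree T) where

  open Walks T
  open Acyclic (proj₂ tree) public

  private
    variable
      a b c x y z s : Fin n
      p : List (Fin n)

  path : Fin n → Fin n → List (Fin n)
  path a b = proj₁ (proj₁ tree a b)

  path-isPath : ∀ a b → IsPath T a b (path a b)
  path-isPath a b = proj₂ (proj₁ tree a b)

  path-walk : ∀ a b → IsWalk T a b (path a b)
  path-walk a b = proj₁ (path-isPath a b)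

  path-start : a ∈ path a b
  path-start = walk-start (path-walk _ _)

  path-end : b ∈ path a b
  path-end = walk-end (path-walk _ _)

  path-minimal : IsWalk T a b p → path a b ⊆ p
  path-minimal {a} {b} wk with q , pq , q⊆p ← loop-erasure wk =
    λ x∈ → q⊆p (subst (_ ∈_) (path-unique (path-isPath a b) pq) x∈)

  path-sym : path a b ⊆ path b a
  path-sym {a} {b} with r , wr , r⊆ ← walk-reverse (path-walk b a) =
    λ x∈ → r⊆ (path-minimal wr x∈)

  path-triangle : ∀ b → x ∈ path a c → x ∈ path a b ⊎ x ∈ path b c
  path-triangle {a = a} {c} b x∈
    with r , wr , r⊆ ← walk-++ (path-walk a b) (path-walk b c) =
    ∈-++⁻ (path a b) (r⊆ (path-minimal wr x∈))

  prefix-⊆ : IsWalk T a b p → c ∈ p → path a c ⊆ p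
  prefix-⊆ wk c∈p with xs , ys , refl ← ∈-∃++ c∈p = λ x∈ →
    [ ∈-++⁺ˡ , (λ { (here refl) → ∈-++⁺ʳ xs (here refl) }) ]
      (∈-++⁻ xs (path-minimal (walk-prefix xs wk) x∈))

  prefix-end : IsPath T a b p → c ∈ p → b ∈ path a c → b ≡ c
  prefix-end (wk , up) c∈p b∈ with xs , ys , refl ← ∈-∃++ c∈p
    with ∈-++⁻ xs (path-minimal (walk-prefix xs wk) b∈)
  ... | inj₁ b∈xs      = ⊥-elim (unique-disjoint xs up b∈xs (walk-end (walk-suffix xs wk)))
  ... | inj₂ (here eq) = eq

  path-prefix : c ∈ path a b → path a c ⊆ path a b
  path-prefix = prefix-⊆ (path-walk _ _)

  path-antisym : c ∈ path a b → b ∈ path a c → b ≡ c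
  path-antisym = prefix-end (path-isPath _ _)

  path-self : ∀ a → path a a ≡ a ∷ []
  path-self a = path-unique (path-isPath a a) (single , [] ∷ [])

  adj-≢ : Adj T a b → a ≢ b
  adj-≢ {a} e refl = Graph.irrefl T e

  path-edge : Adj T a b → path a b ≡ a ∷ b ∷ []
  path-edge e = path-unique (path-isPath _ _)
    (step e single , (adj-≢ e ∷ []) ∷ [] ∷ [])

  path-extend : Adj T x z → x ∉ path z s → path x s ≡ x ∷ path z s
  path-extend {z = z} {s} e x∉ = path-unique (path-isPath _ _)
    (step e (path-walk z s) , ¬Any⇒All¬ _ x∉ ∷ proj₂ (path-isPath z s))

  path-first-step : x ≢ y → ∃ λ z → Adj T x z × path x y ≡ x ∷ path z y
  path-first-step {x} {y} x≢y = first (path-isPath x y)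
    where
    first : IsPath T x y p → ∃ λ z → Adj T x z × p ≡ x ∷ path z y
    first (single , _)               = ⊥-elim (x≢y refl)
    first (step {w = z} e wk , _ ∷ u) = z , e , cong (x ∷_) (path-unique (wk , u) (path-isPath z y))

size : ∀ {m} {A : Fin m → Set} → Decidable A → ℕ
size {zero}  A? = 0
size {suc m} A? with A? fzero
... | yes _ = suc (size (A? ∘ fsuc))
... | no  _ = size (A? ∘ fsuc)

size-bound : ∀ {m} {A : Fin m → Set} (A? : Decidable A) → size A? ≤ m
size-bound {zero}  A? = z≤n
size-bound {suc m} A? with A? fzero
... | yes _ = s≤s (size-bound (A? ∘ fsuc))
... | no  _ = m≤n⇒m≤1+n (size-bound (A? ∘ fsuc))

size-pos : ∀ {m} {A : Fin m → Set} (A? : Decidable A) → ∀ {x} → A x → 0 < size A?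
size-pos A? {fzero} a with A? fzero
... | yes _ = s≤s z≤n
... | no ¬a = ⊥-elim (¬a a)
size-pos A? {fsuc x} a with A? fzero
... | yes _ = s≤s z≤n
... | no  _ = size-pos (A? ∘ fsuc) a

size-mono : ∀ {m} {A B : Fin m → Set} (A? : Decidable A) (B? : Decidable B) →
            (∀ {x} → A x → B x) → size A? ≤ size B?
size-mono {zero}  A? B? A⊆B = z≤n
size-mono {suc m} A? B? A⊆B with A? fzero | B? fzero | size-mono (A? ∘ fsuc) (B? ∘ fsuc) A⊆B
... | yes a | no ¬b | _  = ⊥-elim (¬b (A⊆B a))
... | yes _ | yes _ | le = s≤s le
... | no  _ | yes _ | le = m≤n⇒m≤1+n le
... | no  _ | no  _ | le = le

size-disjoint : ∀ {m} {A B C : Fin m → Set} (A? : Decidable A) (B? : Decidable B) (C? : Decidable C) →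
  (∀ {x} → A x → B x → ⊥) → (∀ {x} → A x → C x) → (∀ {x} → B x → C x) →
  size A? + size B? ≤ size C?
size-disjoint {zero} A? B? C? _ _ _ = z≤n
size-disjoint {suc m} A? B? C? disj A⊆C B⊆C
  with A? fzero | B? fzero | C? fzero
     | size-disjoint (A? ∘ fsuc) (B? ∘ fsuc) (C? ∘ fsuc) disj A⊆C B⊆C
... | yes a | yes b | _     | _  = ⊥-elim (disj a b)
... | yes a | no  _ | no ¬c | _  = ⊥-elim (¬c (A⊆C a))
... | no  _ | yes b | no ¬c | _  = ⊥-elim (¬c (B⊆C b))
... | yes _ | no  _ | yes _ | le = s≤s le
... | no  _ | yes _ | yes _ | le =
  subst (_≤ suc (size (C? ∘ fsuc))) (≡-sym (+-suc (size (A? ∘ fsuc)) _)) (s≤s le)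
... | no  _ | no  _ | yes _ | le = m≤n⇒m≤1+n le
... | no  _ | no  _ | no  _ | le = le

size-strict : ∀ {m} {A B : Fin m → Set} (A? : Decidable A) (B? : Decidable B) →
  (∀ {x} → A x → B x) → ∀ {z} → B z → ¬ A z → size A? < size B?
size-strict A? B? A⊆B {z} bz ¬az = begin
  suc (size A?)          ≡⟨ +-comm 1 (size A?) ⟩
  size A? + 1            ≤⟨ +-monoʳ-≤ (size A?) (size-pos is-z? refl) ⟩
  size A? + size is-z?   ≤⟨ size-disjoint A? is-z? B? (λ { a refl → ¬az a }) A⊆B
                                            (λ { refl → bz }) ⟩
  size B?                ∎
  where
  open ≤-Reasoning
  is-z? : Decidable (_≡ z)
  is-z? x = x ≟ z

below-half : ∀ {a b c} → a + b ≤ c → c < 2 * b → a < b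
below-half {a} {b} {c} a+b≤c c<2b = +-cancelʳ-≤ b (suc a) b (begin
  suc a + b    ≤⟨ s≤s a+b≤c ⟩
  suc c        ≤⟨ c<2b ⟩
  2 * b        ≡⟨ cong (b +_) (+-identityʳ b) ⟩
  b + b        ∎)
  where open ≤-Reasoning

least : ∀ {m} {Q : Fin m → Set} → Decidable Q → ∀ {z} → Q z →
        ∃ λ w → Q w × (∀ v → toℕ v < toℕ w → ¬ Q v)
least {suc m} Q? {z} qz with Q? fzero
... | yes q₀ = fzero , q₀ , λ _ ()
... | no ¬q₀ with z
...   | fzero  = ⊥-elim (¬q₀ qz)
...   | fsuc z′ with w , qw , below ← least (Q? ∘ fsuc) qz =
  fsuc w , qw , λ { fzero _ → ¬q₀ ; (fsuc v) (s≤s v<w) → below v v<w }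

module Components {n : ℕ} (T : Graph n) (tree : IsTree T) where

  open TreePaths T tree
  open import Data.List.Membership.DecPropositional (_≟_ {n}) using (_∈?_)

  private
    variable
      R : Fin n → Set
      a b c u x y z : Fin n

  -- Joined R a b: the tree path from a to b runs inside R, i.e. a and b lie in
  -- the same component of the subforest of T induced by R.
  Joined : (Fin n → Set) → Fin n → Fin n → Set
  Joined R a b = All R (path a b)

  joined? : Decidable R → ∀ a → Decidable (Joined R a)
  joined? R? a b = all-List? R? (path a b)

  joined-refl : R a → Joined R a a
  joined-refl {R} {a} r = subst (All R) (≡-sym (path-self a)) (r ∷ [])

  joined-sym : Joined R a b → Joined R b a
  joined-sym j = All.tabulate (All.lookup j ∘ path-sym)

  joined-trans : Joined R a b → Joined R b c → Joined R a c
  joined-trans {b = b} j k = All.tabulate ([ All.lookup j , All.lookup k ] ∘ path-triangle b)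

  joined-start : Joined R a b → R a
  joined-start j = All.lookup j path-start

  joined-end : Joined R a b → R b
  joined-end j = All.lookup j path-end

  joined-within : Joined R u y → a ∈ path u y → b ∈ path u y → Joined R a b
  joined-within {R} {u} {y} j a∈ b∈ = joined-trans (joined-sym (up-to a∈)) (up-to b∈)
    where
    up-to : ∀ {c} → c ∈ path u y → Joined R u c
    up-to c∈ = All.tabulate (All.lookup j ∘ path-prefix c∈)

  -- the set R with the vertex x removed; the components of R ─ x containing
  -- the neighbours of x are the branches of x
  _─_ : (Fin n → Set) → Fin n → Fin n → Set
  (R ─ x) s = R s × s ≢ x

  _─?_ : Decidable R → ∀ x → Decidable (R ─ x)
  (R? ─? x) s = R? s ×-dec ¬? (s ≟ x)

  forget-─ : Joined (R ─ x) a b → Joined R a b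
  forget-─ = All.map proj₁

  avoids : Joined (R ─ x) a b → x ∉ path a b
  avoids j x∈ = proj₂ (All.lookup j x∈) refl

  module Region {R : Fin n → Set} (R? : Decidable R) where

    component-size : Fin n → ℕ
    component-size a = size (joined? R? a)

    branch-size : Fin n → Fin n → ℕ
    branch-size x y = size (joined? (R? ─? x) y)

    component-⊆ : Joined R a b → component-size b ≤ component-size a
    component-⊆ {a} {b} j = size-mono (joined? R? b) (joined? R? a) (joined-trans j)

    Heavy : Fin n → Fin n → Set
    Heavy x y = Joined R x y × y ≢ x × component-size x < 2 * branch-size x y

    IsCentroid : Fin n → Set
    IsCentroid x = ∀ y → ¬ Heavy x y

    heavy? : ∀ x → Decidable (Heavy x)
    heavy? x y = joined? R? x y ×-dec ¬? (y ≟ x) ×-dec (component-size x <? 2 * branch-size x y)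

    centroid? : Decidable IsCentroid
    centroid? x = all-Fin? (λ y → ¬? (heavy? x y))

    centroid-balanced : IsCentroid x → Joined R x y → y ≢ x →
                        2 * branch-size x y ≤ component-size x
    centroid-balanced cx j y≢x = ≮⇒≥ (λ big → cx _ (j , y≢x , big))

    -- If x has a heavy branch, so has x through the first vertex z on the
    -- way into it, since that branch contains the former.
    heavy-first-step : Heavy x y → ∃ λ z → Adj T x z × Heavy x z
    heavy-first-step {x} {y} (jxy , y≢x , big)
      with z , e , split ← path-first-step {x} {y} (y≢x ∘ ≡-sym) =
      z , e , jxz , adj-≢ e ∘ ≡-sym ,
      <-≤-trans big (*-monoʳ-≤ 2 (size-mono (joined? (R? ─? x) y) (joined? (R? ─? x) z) widen))
      where
      zy⊆xy : ∀ {q} → q ∈ path z y → q ∈ path x y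
      zy⊆xy q∈ = subst (_ ∈_) (≡-sym split) (there q∈)
      x∉zy : x ∉ path z y
      x∉zy with subst Unique split (proj₂ (path-isPath x y))
      ... | x≢ ∷ _ = All¬⇒¬Any x≢
      jxz : Joined R x z
      jxz = subst (All R) (≡-sym (path-edge e))
                  (joined-start jxy ∷ All.lookup jxy (zy⊆xy path-start) ∷ [])
      widen : ∀ {s} → Joined (R ─ x) y s → Joined (R ─ x) z s
      widen jys = All.tabulate (λ q∈ →
        [ (λ q∈zy → All.lookup jxy (zy⊆xy q∈zy) , λ { refl → x∉zy q∈zy }) , All.lookup jys ]
          (path-triangle y q∈))

    -- The branch of z containing x is disjoint from the branch of x containing
    -- z, and both lie in the component of x; the latter being heavy, the
    -- former is smaller.
    branch-back : ∀ {t} → Adj T x z → Heavy x z → Joined (R ─ z) t x →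
                  branch-size z t < branch-size x z
    branch-back {x} {z} {t} e (jxz , _ , big) jtx =
      below-half (size-disjoint (joined? (R? ─? z) t) (joined? (R? ─? x) z) (joined? R? x)
                                disjoint toward-x (joined-trans jxz ∘ forget-─)) big
      where
      toward-x : ∀ {s} → Joined (R ─ z) t s → Joined R x s
      toward-x jts = forget-─ (joined-trans (joined-sym jtx) jts)
      -- a vertex s of both would have z on its path from x, as x ∉ path z s
      disjoint : ∀ {s} → Joined (R ─ z) t s → Joined (R ─ x) z s → ⊥
      disjoint jts jzs
        with path-triangle t (subst (z ∈_) (≡-sym (path-extend e (avoids jzs))) (there path-start))
      ... | inj₁ z∈xt = avoids jtx (path-sym z∈xt)
      ... | inj₂ z∈ts = avoids jts z∈ts

    -- A branch of z not containing x lies in the branch of x containing z,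
    -- and misses z itself.
    branch-ahead : ∀ {t} → Adj T x z → Joined R x z → Joined R z t → z ∈ path t x →
                   branch-size z t < branch-size x z
    branch-ahead {x} {z} {t} e jxz jzt z∈tx =
      size-strict (joined? (R? ─? z) t) (joined? (R? ─? x) z) shrink
                  (joined-refl (joined-end jxz , adj-≢ e ∘ ≡-sym)) (λ jtz → avoids jtz path-end)
      where
      shrink : ∀ {s} → Joined (R ─ z) t s → Joined (R ─ x) z s
      shrink {s} jts = All.tabulate (λ q∈ → in-R q∈ , λ { refl → x-off q∈ })
        where
        in-R : ∀ {q} → q ∈ path z s → R q
        in-R q∈ = [ All.lookup jzt , proj₁ ∘ All.lookup jts ] (path-triangle t q∈)
        -- z separates t from x, so x on the way from z to s would put z
        -- on the way from t to s
        x-off : x ∉ path z s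
        x-off x∈zs with path-triangle s z∈tx
        ... | inj₁ z∈ts = avoids jts z∈ts
        ... | inj₂ z∈sx = adj-≢ e (≡-sym (path-antisym (path-sym x∈zs) z∈sx))

    heavy-neighbour : Adj T x z → Heavy x z → ∀ t → Joined R z t →
                      branch-size z t < branch-size x z
    heavy-neighbour {x} {z} e hz@(jxz , _ , _) t jzt with z ∈? path t x
    ... | yes z∈tx = branch-ahead e jxz jzt z∈tx
    ... | no  z∉tx = branch-back e hz
      (All.tabulate (λ q∈ → All.lookup (joined-trans (joined-sym jzt) (joined-sym jxz)) q∈
                          , λ { refl → z∉tx q∈ }))

    -- Walking into heavy branches strictly decreases the largest branch size,
    -- so the walk ends at a centroid.
    centroid-exists : R u → ∃ λ x → Joined R u x × IsCentroid x
    centroid-exists {u} ru =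
      search (suc n) u (joined-refl ru) (λ y _ → s≤s (size-bound (joined? (R? ─? u) y)))
      where
      search : ∀ N x → Joined R u x → (∀ y → Joined R x y → branch-size x y < N) →
               ∃ λ x → Joined R u x × IsCentroid x
      search N x jux below with any-Fin? (heavy? x)
      ... | no none = x , jux , λ y h → none (y , h)
      ... | yes (_ , h) with z , e , hz@(jxz , _ , _) ← heavy-first-step h
        with N | below z jxz
      ...   | suc N′ | bz<N = search N′ z (joined-trans jux jxz)
                (λ t jzt → <-≤-trans (heavy-neighbour e hz t jzt) (≤-pred bz<N))

    Chosen : Fin n → Set
    Chosen x = R x × IsCentroid x × (∀ w → toℕ w < toℕ x → Joined R x w → ¬ IsCentroid w)

    chosen? : Decidable Chosen
    chosen? x = R? x ×-dec centroid? x ×-dec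
      all-Fin? (λ w → (toℕ w <? toℕ x) →-dec (joined? R? x w →-dec ¬? (centroid? w)))

    chosen-exists : R y → ∃ λ x → Joined R y x × Chosen x
    chosen-exists {y} ry with c , jyc , cc ← centroid-exists ry
      with x , (jyx , cx) , least-x ← least (λ w → joined? R? y w ×-dec centroid? w) (jyc , cc) =
      x , jyx , joined-end jyx , cx , λ w w<x jxw cw → least-x w w<x (joined-trans jyx jxw , cw)

    chosen-unique : Joined R a b → Chosen a → Chosen b → a ≡ b
    chosen-unique {a} {b} j (_ , ca , least-a) (_ , cb , least-b) with <-cmp (toℕ a) (toℕ b)
    ... | tri< a<b _ _ = ⊥-elim (least-b a a<b (joined-sym j) ca)
    ... | tri≈ _ a≡b _ = toℕ-injective a≡b
    ... | tri> _ _ b<a = ⊥-elim (least-a b b<a j cb)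

module Ranking {n : ℕ} (T : Graph n) (tree : IsTree T) where

  open TreePaths T tree
  open Components T tree

  UniqueMax : (Fin n → ℕ) → List (Fin n) → Set
  UniqueMax c p = ∃ λ x → x ∈ p × (∀ {y} → y ∈ p → y ≢ x → c y < c x)

  -- One round of the decomposition removes the chosen centroids from R.  The
  -- remaining components lie in branches of chosen centroids, so they are
  -- at most half as large; colouring the chosen centroids above all other
  -- vertices keeps a unique maximum on every path, since a path inside R
  -- meets at most one chosen centroid.
  module Peel {R : Fin n → Set} (R? : Decidable R) where

    open Region R?

    Rest : Fin n → Set
    Rest s = R s × ¬ Chosen s

    rest? : Decidable Rest
    rest? s = R? s ×-dec ¬? (chosen? s)

    -- the component of y in Rest lies in the branch towards y of the chosen
    -- centroid x of its component in R, which is at most half as large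
    rest-small : ∀ k → (∀ y → R y → component-size y < 2 ^ suc k) →
                 ∀ y → Rest y → Region.component-size rest? y < 2 ^ k
    rest-small k small y (ry , ¬cy) with x , jyx , cx@(_ , centroid , _) ← chosen-exists ry =
      *-cancelˡ-< 2 _ _ (begin-strict
        2 * Region.component-size rest? y  ≤⟨ *-monoʳ-≤ 2 (size-mono (joined? rest? y)
                                                         (joined? (R? ─? x) y) in-branch) ⟩
        2 * branch-size x y                ≤⟨ centroid-balanced centroid (joined-sym jyx) y≢x ⟩
        component-size x                   ≤⟨ component-⊆ jyx ⟩
        component-size y                   <⟨ small y ry ⟩
        2 ^ suc k                          ∎)
      where
      open ≤-Reasoning
      y≢x : y ≢ x
      y≢x refl = ¬cy cx
      in-branch : ∀ {s} → Joined Rest y s → Joined (R ─ x) y s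
      in-branch = All.map (λ { (rq , ¬cq) → rq , λ { refl → ¬cq cx } })

    extend : ∀ k (c′ : Fin n → ℕ) → (∀ y → Rest y → c′ y < k) →
             (∀ u v → Joined Rest u v → UniqueMax c′ (path u v)) →
             ∃ λ c → (∀ y → R y → c y < suc k) ×
                     (∀ u v → Joined R u v → UniqueMax c (path u v))
    extend k c′ c′<k c′-max = c , c<1+k , c-max
      where
      c : Fin n → ℕ
      c s with chosen? s
      ... | yes _ = k
      ... | no  _ = c′ s

      c-chosen : ∀ {s} → Chosen s → c s ≡ k
      c-chosen {s} cs with chosen? s
      ... | yes _  = refl
      ... | no ¬cs = ⊥-elim (¬cs cs)

      c-rest : ∀ {s} → ¬ Chosen s → c s ≡ c′ s
      c-rest {s} ¬cs with chosen? s
      ... | yes cs = ⊥-elim (¬cs cs)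
      ... | no  _  = refl

      c<1+k : ∀ y → R y → c y < suc k
      c<1+k y ry with chosen? y
      ... | yes _   = ≤-refl
      ... | no  ¬cy = m≤n⇒m≤1+n (c′<k y (ry , ¬cy))

      c-max : ∀ u v → Joined R u v → UniqueMax c (path u v)
      c-max u v j with any-List? chosen? (path u v)
      ... | yes some with x , x∈ , cx ← find some =
        x , x∈ , λ y∈ y≢x → subst (c _ <_) (≡-sym (c-chosen cx)) (below-k y∈ y≢x)
        where
        below-k : ∀ {y} → y ∈ path u v → y ≢ x → c y < k
        below-k {y} y∈ y≢x with chosen? y
        ... | yes cy  = ⊥-elim (y≢x (chosen-unique (joined-within j y∈ x∈) cy cx))
        ... | no  ¬cy = c′<k y (All.lookup j y∈ , ¬cy)
      ... | no none with x , x∈ , max ← c′-max u v (All.zip (j , ¬Any⇒All¬ _ none)) =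
        x , x∈ , λ y∈ y≢x →
          subst₂ _<_ (≡-sym (c-rest (unchosen y∈))) (≡-sym (c-rest (unchosen x∈))) (max y∈ y≢x)
        where
        unchosen : ∀ {y} → y ∈ path u v → ¬ Chosen y
        unchosen = All.lookup (¬Any⇒All¬ _ none)

  ranking : ∀ k {R} (R? : Decidable R) → (∀ y → R y → Region.component-size R? y < 2 ^ k) →
            ∃ λ c → (∀ y → R y → c y < k) × (∀ u v → Joined R u v → UniqueMax c (path u v))
  ranking zero {R} R? small =
    (λ _ → 0) , (λ _ → ⊥-elim ∘ empty) , λ _ _ → ⊥-elim ∘ empty ∘ joined-start
    where
    -- a component contains at least its own vertex
    empty : ∀ {y} → R y → ⊥
    empty {y} ry = ≤⇒≯ (size-pos (joined? R? y) (joined-refl ry)) (small y ry)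
  ranking (suc k) R? small
    with c′ , c′<k , c′-max ← ranking k (Peel.rest? R?) (Peel.rest-small R? k small) =
    Peel.extend R? k c′ c′<k c′-max

  -- Colouring each vertex by its rank gives a conflict-free colouring: on
  -- every path the unique vertex of maximal rank has a colour of its own.
  tree-colourable : ∀ b → n < 2 ^ b → CFVColourable T b
  tree-colourable b n<2^b
    with c , c<b , c-max ← ranking b {λ _ → ⊤} (λ _ → yes tt)
                             (λ y _ → ≤-<-trans (size-bound (joined? (λ _ → yes tt) y)) n<2^b) =
    colour , λ u v → path u v , path-isPath u v , conflict-free u v
    where
    colour : Fin n → Fin b
    colour y = fromℕ< (c<b y tt)

    same-rank : ∀ {x y} → colour y ≡ colour x → c y ≡ c x
    same-rank eq = trans (≡-sym (toℕ-fromℕ< _)) (trans (cong toℕ eq) (toℕ-fromℕ< _))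

    conflict-free : ∀ u v → ConflictFree T colour (path u v)
    conflict-free u v with x , x∈ , max ← c-max u v (All.universal (λ _ → tt) _) =
      colour x , filter-single (λ y → colour y ≟ colour x) (proj₂ (path-isPath u v)) x∈ refl
                   (λ y∈ y≢x same → <-irrefl (same-rank same) (max y∈ y≢x))

module Segments {V C : Set} (_≟ᶜ_ : DecidableEquality C) (f : V → C) where

  occurrences : C → List V → ℕ
  occurrences c xs = length (filter (λ x → f x ≟ᶜ c) xs)

  SegmentsCF : List V → Set
  SegmentsCF xs = ∀ ys zs ws → xs ≡ ys ++ zs ++ ws → zs ≢ [] → ∃ λ c → occurrences c zs ≡ 1

  segmentsCF-left : ∀ ys {zs} → SegmentsCF (ys ++ zs) → SegmentsCF ys
  segmentsCF-left _ {zs} cf as ms bs refl = cf as ms (bs ++ zs) (begin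
    (as ++ ms ++ bs) ++ zs  ≡⟨ ++-assoc as (ms ++ bs) zs ⟩
    as ++ (ms ++ bs) ++ zs  ≡⟨ cong (as ++_) (++-assoc ms bs zs) ⟩
    as ++ ms ++ bs ++ zs    ∎)
    where open ≡-Reasoning

  segmentsCF-right : ∀ ys {zs} → SegmentsCF (ys ++ zs) → SegmentsCF zs
  segmentsCF-right ys cf as ms bs refl = cf (ys ++ as) ms bs (≡-sym (++-assoc ys as (ms ++ bs)))

  no-occurrence : ∀ {c} xs → occurrences c xs ≡ 0 → All (λ x → f x ≢ c) xs
  no-occurrence []       _ = []
  no-occurrence {c} (x ∷ xs) none with f x ≟ᶜ c
  ... | no fx≢c = fx≢c ∷ no-occurrence xs none

  split-unique-colour : ∀ {c} xs → occurrences c xs ≡ 1 →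
    ∃₂ λ ys ws → ∃ λ y → xs ≡ ys ++ y ∷ ws × f y ≡ c ×
                          All (λ x → f x ≢ c) ys × All (λ x → f x ≢ c) ws
  split-unique-colour {c} (x ∷ xs) once with f x ≟ᶜ c
  ... | yes fx≡c = [] , xs , x , refl , fx≡c , [] , no-occurrence xs (suc-injective once)
  ... | no  fx≢c with ys , ws , y , refl , fy≡c , ys-off , ws-off ← split-unique-colour xs once =
    x ∷ ys , ws , y , refl , fy≡c , fx≢c ∷ ys-off , ws-off

  segments-bound : ∀ b (K : List C) xs → length K ≤ b → (∀ {x} → x ∈ xs → f x ∈ K) →
                   SegmentsCF xs → length xs < 2 ^ b
  segments-bound b K [] _ _ _ = m^n>0 2 b
  segments-bound zero [] (x ∷ _) _ inK _ with () ← inK (here refl)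
  segments-bound (suc b) K (x ∷ xs) K≤ inK cf
    with c , once ← cf [] (x ∷ xs) [] (≡-sym (++-identityʳ (x ∷ xs))) (λ ())
    with ys , ws , y , split , fy≡c , ys-off , ws-off ← split-unique-colour (x ∷ xs) once =
    subst (_< 2 ^ suc b) (≡-sym (trans (cong length split) (length-++ ys))) (begin-strict
      length ys + suc (length ws)  <⟨ +-mono-≤ (bound-on ys ys-off ∈-++⁺ˡ left)
                                                (bound-on ws ws-off (∈-++⁺ʳ ys ∘ there) right) ⟩
      2 ^ b + 2 ^ b                ≡⟨ cong (2 ^ b +_) (≡-sym (+-identityʳ (2 ^ b))) ⟩
      2 ^ suc b                    ∎)
    where
    open ≤-Reasoning
    cf′ : SegmentsCF (ys ++ y ∷ ws)
    cf′ = subst SegmentsCF split cf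
    left : SegmentsCF ys
    left = segmentsCF-left ys cf′
    right : SegmentsCF ws
    right = segmentsCF-right (y ∷ []) (segmentsCF-right ys cf′)
    K′ : List C
    K′ = filter (λ k → ¬? (k ≟ᶜ c)) K
    K′≤b : length K′ ≤ b
    K′≤b = ≤-pred (<-≤-trans (filter-notAll (λ k → ¬? (k ≟ᶜ c)) K c∈K) K≤)
      where
      c∈K : Any (λ k → ¬ ¬ k ≡ c) K
      c∈K = Any.map (λ { refl ¬c≡c → ¬c≡c refl })
              (subst (_∈ K) fy≡c (inK (subst (y ∈_) (≡-sym split) (∈-++⁺ʳ ys (here refl)))))
    bound-on : ∀ zs → All (λ x → f x ≢ c) zs → (∀ {z} → z ∈ zs → z ∈ ys ++ y ∷ ws) →
               SegmentsCF zs → length zs < 2 ^ b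
    bound-on zs off ⊆ys+ws cfz = segments-bound b K′ zs K′≤b
      (λ z∈ → ∈-filter⁺ (λ k → ¬? (k ≟ᶜ c)) (inK (subst (_ ∈_) (≡-sym split) (⊆ys+ws z∈)))
                        (All.lookup off z∈))
      cfz

module PathGraphPaths (n : ℕ) where

  open Walks (PathGraph n)

  private
    variable
      u v w : Fin n
      k : ℕ
      p q : List (Fin n)

  step-below : ∀ {m} → Adj (PathGraph n) w v → toℕ w < m → toℕ v ≢ m → toℕ v < m
  step-below {w} {v} {m} (inj₁ up)   w<m v≢m = ≤∧≢⇒< (subst (_≤ m) (≡-sym up) w<m) v≢m
  step-below {w} {v} {m} (inj₂ down) w<m _   = <-trans (subst (toℕ v <_) (≡-sym down) (n<1+n _)) w<m

  walk-crosses : IsWalk (PathGraph n) w v p → ∀ m → toℕ w < m → m ≤ toℕ v →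
                 ∃ λ t → t ∈ p × toℕ t ≡ m
  walk-crosses single m w<m m≤v = ⊥-elim (<-irrefl refl (<-≤-trans w<m m≤v))
  walk-crosses (step {w = w′} e wk) m w<m m≤v with toℕ w′ ≟ℕ m
  ... | yes w′≡m = w′ , there (walk-start wk) , w′≡m
  ... | no  w′≢m with t , t∈ , t≡m ← walk-crosses wk m (step-below e w<m w′≢m) m≤v =
    t , there t∈ , t≡m

  steps-up : Adj (PathGraph n) u w → IsWalk (PathGraph n) w v p → u ∉ p → toℕ u ≤ toℕ v →
             toℕ w ≡ suc (toℕ u)
  steps-up (inj₁ up) _ _ _ = up
  steps-up {u} (inj₂ down) wk u∉p u≤v
    with t , t∈ , t≡u ← walk-crosses wk (toℕ u) (subst (_ <_) (≡-sym down) (n<1+n _)) u≤v =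
    ⊥-elim (u∉p (subst (_∈ _) (toℕ-injective t≡u) t∈))

  path-unique : IsPath (PathGraph n) u v p → IsPath (PathGraph n) u v q → toℕ u ≤ toℕ v → p ≡ q
  path-unique (single , _) (single , _) _ = refl
  path-unique (single , _) (step _ wq , q₀ ∷ _) _ = ⊥-elim (All¬⇒¬Any q₀ (walk-end wq))
  path-unique (step _ wp , p₀ ∷ _) (single , _) _ = ⊥-elim (All¬⇒¬Any p₀ (walk-end wp))
  path-unique {u} {v} (step e₁ wp , p₀ ∷ up) (step e₂ wq , q₀ ∷ uq) u≤v
    with toℕ-injective (trans (steps-up e₁ wp (All¬⇒¬Any p₀) u≤v)
                              (≡-sym (steps-up e₂ wq (All¬⇒¬Any q₀) u≤v)))
  ... | refl = cong (u ∷_) (path-unique (wp , up) (wq , uq)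
                 (subst (_≤ toℕ v) (≡-sym (steps-up e₁ wp (All¬⇒¬Any p₀) u≤v)) u<v))
    where
    u<v : toℕ u < toℕ v
    u<v = ≤∧≢⇒< u≤v (λ u≡v →
            All¬⇒¬Any p₀ (subst (_∈ _) (≡-sym (toℕ-injective u≡v)) (walk-end wp)))

  data Run : ℕ → List (Fin n) → Set where
    []  : Run k []
    _∷_ : ∀ {x} → toℕ x ≡ k → Run (suc k) p → Run k (x ∷ p)

  run-tabulate : ∀ {m} (g : Fin m → Fin n) → (∀ i → toℕ (g i) ≡ k + toℕ i) →
                 Run k (tabulate g)
  run-tabulate {k} {zero}  g at = []
  run-tabulate {k} {suc m} g at =
    trans (at fzero) (+-identityʳ k) ∷
    run-tabulate (g ∘ fsuc) (λ i → trans (at (fsuc i)) (+-suc k (toℕ i)))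

  run-allFin : Run 0 (allFin n)
  run-allFin = run-tabulate id (λ _ → refl)

  run-left : ∀ ys {zs} → Run k (ys ++ zs) → Run k ys
  run-left []       _            = []
  run-left (_ ∷ ys) (at ∷ run) = at ∷ run-left ys run

  run-right : ∀ ys {zs} → Run k (ys ++ zs) → ∃ λ k′ → Run k′ zs
  run-right []       run        = _ , run
  run-right (_ ∷ ys) (_ ∷ run) = run-right ys run

  run-above : Run k p → All (λ z → k ≤ toℕ z) p
  run-above []           = []
  run-above (at ∷ run) = ≤-reflexive (≡-sym at) ∷ All.map <⇒≤ (run-above run)

  run-path : ∀ {x} → Run k (x ∷ p) →
             ∃ λ e → IsPath (PathGraph n) x e (x ∷ p) × toℕ x ≤ toℕ e
  run-path (_ ∷ []) = _ , (single , [] ∷ []) , ≤-refl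
  run-path {k} {x = x} (at ∷ run@(_∷_ {x = y} at′ _)) with e , (wk , uq) , y≤e ← run-path run =
    e , (step (inj₁ y≡1+x) wk , All.map x≢ (run-above run) ∷ uq) ,
    ≤-trans (subst (toℕ x ≤_) (≡-sym y≡1+x) (n≤1+n _)) y≤e
    where
    y≡1+x : toℕ y ≡ suc (toℕ x)
    y≡1+x = trans at′ (cong suc (≡-sym at))
    x≢ : ∀ {z} → k < toℕ z → x ≢ z
    x≢ k<z x≡z = <-irrefl (trans (≡-sym at) (cong toℕ x≡z)) k<z

-- A conflict-free colouring of P_n with b colours forces n < 2^b: the
-- colours along the vertex list 0, 1, …, n-1 are conflict-free on every
-- segment, because each segment is the unique path between its ends.
path-lower-bound : ∀ n b → CFVColourable (PathGraph n) b → n < 2 ^ b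
path-lower-bound n b (c , cfv) =
  subst (_< 2 ^ b) (length-tabulate id)
    (segments-bound b (allFin b) (allFin n) (≤-reflexive (length-tabulate id))
                    (λ _ → ∈-allFin _) segments)
  where
  open PathGraphPaths n
  open Segments _≟_ c
  segments : SegmentsCF (allFin n)
  segments ys []      ws _     []≢[] = ⊥-elim ([]≢[] refl)
  segments ys (x ∷ p) ws split _
    with _ , run ← run-right ys (subst (Run 0) split run-allFin)
    with e , isPath , x≤e ← run-path (run-left (x ∷ p) run)
    with q , isPath′ , cf ← cfv x e =
    subst (λ l → ∃ λ col → occurrences col l ≡ 1) (path-unique isPath′ isPath x≤e) cf

theorem2p2 : (n : ℕ) (T : Graph n) → IsTree T →
    ∀ a b → IsVcfc T a → IsVcfc (PathGraph n) b → a ≤ b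
theorem2p2 n T tree a b (_ , minimal) (path-colouring , _) =
  ≮⇒≥ (λ b<a → minimal b b<a
         (Ranking.tree-colourable T tree b (path-lower-bound n b path-colouring)))
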